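{- Let $w\in S_\infty$, $\mathbf{P}\in\mathrm{SPD}(w)$ and $k\ge0$, and write $\mathbf{Q}=Y^+\mathbf{P}$. The following are equivalent: (a) $P_x$ and $\sigma^k(P_y)$ are both ordinary; (b) $Q_x$ and $\sigma^{k+1}(Q_y)$ are both ordinary.
   Context: Positions $(i,j)\in\mathbb{Z}^2$: $i$ = row (increasing downward), $j$ = column (increasing rightward). Let $\mathcal{H}=\{(i,j): i+j-1\ge1\}$. A pipe dream is a finite subset of $\mathcal{H}$; it is ordinary if contained in $\mathbb{N}\times\mathbb{N}$. Its permutation is $\partial(P)=s_{a_1}*\cdots*s_{a_r}$ where $(a_1,\dots,a_r)$ lists the values $i+j-1$, $(i,j)\in P$, reading rows right to left and top to bottom, and $*$ is the Demazure product. A super pipe dream is a pair $\mathbf{P}=(P_x,P_y)$ of pipe dreams (black checkers at $P_x$, red at $P_y$; a position may hold both; positions outside $\mathcal{H}$ hold none); its permutation is $\partial(P_x\cup P_y)$; $\mathrm{SPD}(w)$ = those with permutation $w$. Shift: $\sigma(P)=\{(i+1,j-1):(i,j)\in P\}$. Flow operator $Y^+_j$, on super pipe dreams with no red checker in column $j+1$: repeat until column $j$ has no red checker: let $(i,j)$ be the lowest red checker in column $j$. If $(i,j+1)$ holds no checker, let $i'<i$ be largest with $(i',j)$ holding no checker; move the red checker from $(i,j)$ to $(i',j+1)$ (black checkers at $(i,j)$ or $(i',j+1)$ stay) and for each row $r$ with $i'<r<i$ exchange the contents of $(r,j)$ and $(r,j+1)$. If $(i,j+1)$ holds a checker, exchange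 the contents of $(i,j)$ and $(i,j+1)$. $Y^+\mathbf{P}=Y^+_mY^+_{m+1}\cdots Y^+_M\mathbf{P}$ where all red checkers of $\mathbf{P}$ lie in columns between $m$ and $M$ (independent of $m,M$). -}

module Defs where

open import Data.Bool using (Bool; true; false; if_then_else_; _∧_)
open import Data.Nat as ℕ using (ℕ; zero; suc)
open import Data.Integer as ℤ using (ℤ; +_; -_; _+_; _-_; ∣_∣)
open import Data.Product using (_×_; _,_; proj₁; proj₂)
open import Data.Product.Properties using (≡-dec)
open import Data.Sum using (_⊎_)
open import Data.List using (List; []; _∷_; map; foldl; concatMap; upTo; _++_)
open import Data.Nat.ListAction using (sum)
open import Data.List.Relation.Unary.All using (All)
open import Data.List.Relation.Unary.Any using (any?)
open import Data.List.Membership.Propositional using (_∈_)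
open import Relation.Nullary using (¬_; does)
open import Relation.Binary.PropositionalEquality using (_≡_)

-- (i , j) : i = row (down), j = column (right)
Pos : Set
Pos = ℤ × ℤ

row col : Pos → ℤ
row = proj₁
col = proj₂

_≟P_ : (p q : Pos) → Relation.Nullary.Dec (p ≡ q)
_≟P_ = ≡-dec ℤ._≟_ ℤ._≟_

_==_ : Pos → Pos → Bool
p == q = does (p ≟P q)

idx : Pos → ℤ
idx (i , j) = i + j - + 1

inH : Pos → Set
inH p = + 1 ℤ.≤ idx p

-- A pipe dream: a finite subset of H, represented by a list of its
-- elements (read as a set: only membership matters).
PipeDream : Set
PipeDream = List Pos

IsPipeDream : PipeDream → Set
IsPipeDream P = All inH P

-- ordinary: contained in ℕ × ℕ, ℕ = {1,2,3,...}
Ordinary : PipeDream → Set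
Ordinary P = All (λ p → (+ 1 ℤ.≤ row p) × (+ 1 ℤ.≤ col p)) P

σ : PipeDream → PipeDream
σ = map (λ p → (row p + + 1 , col p - + 1))

σ^ : ℕ → PipeDream → PipeDream
σ^ zero    P = P
σ^ (suc k) P = σ (σ^ k P)

-- Permutations of {1,2,...} as functions ℕ → ℕ (value at 0 unused,
-- fixed to 0) and the Demazure product.

Perm : Set
Perm = ℕ → ℕ

idPerm : Perm
idPerm n = n

rmulS : Perm → ℕ → Perm
rmulS w a n with n ℕ.≟ a | n ℕ.≟ suc a
... | Relation.Nullary.yes _ | _ = w (suc a)
... | Relation.Nullary.no _ | Relation.Nullary.yes _ = w a
... | Relation.Nullary.no _ | Relation.Nullary.no _ = w n

-- Demazure product w * s_a : equals w s_a if ℓ(w s_a) > ℓ(w)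
-- (i.e. w(a) < w(a+1)), and w otherwise
demS : Perm → ℕ → Perm
demS w a = if does (w a ℕ.<? w (suc a)) then rmulS w a else w

demazure : List ℕ → Perm
demazure = foldl demS idPerm

-- reading word of a pipe dream: values i+j-1 for (i,j) ∈ P, reading rows
-- right to left, and rows top to bottom. Realised by scanning the box
-- [-B,B] × [-B,B] (which contains P) row by row.
bound : PipeDream → ℕ
bound P = suc (sum (map (λ p → ∣ row p ∣ ℕ.+ ∣ col p ∣) P))

memb : Pos → PipeDream → Bool
memb p P = does (any? (p ≟P_) P)

readingWord : PipeDream → List ℕ
readingWord P =
  concatMap (λ i → concatMap (λ j → if memb (i , j) P then ∣ idx (i , j) ∣ ∷ [] else [])
                             cols)
            rows
  where
    B : ℕ
    B = bound P
    rows : List ℤ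
    rows = map (λ t → + t - + B) (upTo (suc (B ℕ.+ B)))
    cols : List ℤ
    cols = map (λ t → + B - + t) (upTo (suc (B ℕ.+ B)))

∂ : PipeDream → Perm
∂ P = demazure (readingWord P)

record SuperPD : Set where
  constructor spd
  field
    Px : PipeDream   -- black checkers
    Py : PipeDream   -- red checkers
open SuperPD public

IsSuperPD : SuperPD → Set
IsSuperPD 𝐏 = IsPipeDream (Px 𝐏) × IsPipeDream (Py 𝐏)

∂S : SuperPD → Perm
∂S 𝐏 = ∂ (Px 𝐏 ++ Py 𝐏)

_∈SPD_ : SuperPD → Perm → Set
𝐏 ∈SPD w = IsSuperPD 𝐏 × (∀ n → ∂S 𝐏 n ≡ w n)

red : SuperPD → Pos → Set
red 𝐏 p = p ∈ Py 𝐏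

-- position p holds a checker (positions outside H hold none)
holds : SuperPD → Pos → Set
holds 𝐏 p = inH p × (p ∈ Px 𝐏 ⊎ p ∈ Py 𝐏)

NoRedInCol : ℤ → SuperPD → Set
NoRedInCol j 𝐏 = ∀ r → ¬ red 𝐏 (r , j)

LowestRed : ℤ → SuperPD → ℤ → Set
LowestRed j 𝐏 i = red 𝐏 (i , j) × (∀ r → red 𝐏 (r , j) → r ℤ.≤ i)

mapS : (Pos → Pos) → SuperPD → SuperPD
mapS f 𝐏 = spd (map f (Px 𝐏)) (map f (Py 𝐏))

exchange : Pos → Pos → SuperPD → SuperPD
exchange p q = mapS (λ e → if e == p then q else if e == q then p else e)

exchangeBetween : ℤ → ℤ → ℤ → SuperPD → SuperPD
exchangeBetween i' i j = mapS f
  where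
    f : Pos → Pos
    f (r , c) =
      if does (i' ℤ.<? r) ∧ does (r ℤ.<? i)
      then (if does (c ℤ.≟ j) then (r , j + + 1)
            else if does (c ℤ.≟ (j + + 1)) then (r , j) else (r , c))
      else (r , c)

moveRed : Pos → Pos → SuperPD → SuperPD
moveRed p q 𝐏 = spd (Px 𝐏) (map (λ e → if e == p then q else e) (Py 𝐏))

-- one iteration of the loop of Y⁺_j
data FlowStep (j : ℤ) (𝐏 : SuperPD) : SuperPD → Set where
  empty-right :
    (i i' : ℤ) → LowestRed j 𝐏 i → ¬ holds 𝐏 (i , j + + 1) →
    i' ℤ.< i → ¬ holds 𝐏 (i' , j) →
    (∀ r → i' ℤ.< r → r ℤ.< i → holds 𝐏 (r , j)) →
    FlowStep j 𝐏 (exchangeBetween i' i j (moveRed (i , j) (i' , j + + 1) 𝐏))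
  full-right :
    (i : ℤ) → LowestRed j 𝐏 i → holds 𝐏 (i , j + + 1) →
    FlowStep j 𝐏 (exchange (i , j) (i , j + + 1) 𝐏)

-- "repeat until column j has no red checker": FlowRun j 𝐏 𝐐 means the
-- loop started at 𝐏 terminates with 𝐐
data FlowRun (j : ℤ) : SuperPD → SuperPD → Set where
  done : ∀ {𝐏} → NoRedInCol j 𝐏 → FlowRun j 𝐏 𝐏
  step : ∀ {𝐏 𝐐 𝐑} → FlowStep j 𝐏 𝐐 → FlowRun j 𝐐 𝐑 → FlowRun j 𝐏 𝐑

YPlusCol : ℤ → SuperPD → SuperPD → Set
YPlusCol j 𝐏 𝐐 = NoRedInCol (j + + 1) 𝐏 × FlowRun j 𝐏 𝐐

-- YPlusCols M n 𝐏 𝐐 : 𝐐 = Y⁺_{M-n+1} ⋯ Y⁺_{M-1} Y⁺_M 𝐏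
data YPlusCols : ℤ → ℕ → SuperPD → SuperPD → Set where
  none : ∀ {M 𝐏} → YPlusCols M zero 𝐏 𝐏
  more : ∀ {M n 𝐏 𝐐 𝐑} → YPlusCol M 𝐏 𝐐 → YPlusCols (M - + 1) n 𝐐 𝐑 →
         YPlusCols M (suc n) 𝐏 𝐑

RedsBetween : ℤ → ℤ → SuperPD → Set
RedsBetween m M 𝐏 = All (λ p → (m ℤ.≤ col p) × (col p ℤ.≤ M)) (Py 𝐏)

-- Y⁺ 𝐏 = 𝐐, computed with columns m ≤ M bounding the red checkers:
-- 𝐐 = Y⁺_m Y⁺_{m+1} ⋯ Y⁺_M 𝐏
YPlusWith : ℤ → ℤ → SuperPD → SuperPD → Set
YPlusWith m M 𝐏 𝐐 = YPlusCols M (suc ∣ M - m ∣) 𝐏 𝐐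

-- Say that 𝐒 is split at column j (SplitOrdinary k j 𝐒) if its black checkers
-- are ordinary, its red checkers in columns ≤ j are σᵏ-ordinary and those in
-- columns > j are σᵏ⁺¹-ordinary. With all red checkers in columns m … M,
-- (a) says that 𝐏 is split at M and (b) that 𝐐 is split at m − 1. So it
-- suffices that Y⁺_j preserves splitness at j in both directions: afterwards
-- column j holds no red checker, and splitness at j and at j − 1 coincide.
--
-- The key identity is σ (r , c + 1) = (r + 1 , c): a red checker moving from
-- column j to column j + 1 must become σᵏ-ordinary one row lower in column j.
-- For a checker slid right within its row this is monotonicity in the row; for
-- the checker jumping from (i , j) to (i' , j + 1) it is what the checker at
-- (i' + 1 , j), guaranteed by the loop, provides. Black checkers only swap
-- between columns j and j + 1, both ≥ 1 as column j holds a σᵏ-ordinary red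
-- checker. Throughout, the loop keeps the red checkers of column j above those
-- of column j + 1, and all red checkers in H and in columns ≥ m.

module Submission where

open import Defs
open import Data.Bool using (if_then_else_; _∧_)
open import Data.Empty using (⊥-elim)
open import Data.Nat using (ℕ; zero; suc)
open import Data.Integer using (ℤ; +_; -_; ∣_∣; _+_; _-_; _≤_; _<_; _<?_; _≟_)
open import Data.Integer.Properties
  using (≤-refl; ≤-trans; <-trans; <-≤-trans; ≤-<-trans; <⇒≤; <⇒≱; <-irrefl; <-asym; ≤∧≢⇒<;
         ≮⇒≥; +-comm; +-identityʳ; +-monoˡ-≤; i≤i+j; i-j≤i;
         suc[i]≤j⇒i<j; i<j⇒suc[i]≤j; i≤pred[j]⇒i<j; i<j⇒i≤pred[j]; 0≤i⇒+∣i∣≡i; i≤j⇒0≤j-i)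
open import Data.Integer.Tactic.RingSolver using (solve-∀)
open import Data.List using (map)
open import Data.List.Properties using (map-id; map-cong; map-∘)
open import Data.List.Membership.Propositional using (_∈_)
open import Data.List.Membership.Propositional.Properties using (∈-map⁺; ∈-map⁻)
open import Data.List.Relation.Unary.All as All using (All)
import Data.List.Relation.Unary.All.Properties as All
open import Data.Product using (_×_; _,_; proj₁; proj₂; ∃)
open import Data.Product.Function.NonDependent.Propositional using (_×-⇔_)
open import Data.Sum using (inj₁; inj₂; [_,_])
open import Function.Base using (id; _∘′_)
open import Function.Bundles using (_⇔_; mk⇔; Equivalence)
import Function.Properties.Equivalence as ⇔
open import Relation.Nullary using (¬_; does; yes; no)
open import Relation.Binary.PropositionalEquality
  using (_≡_; _≢_; refl; sym; trans; cong; cong₂; subst; module ≡-Reasoning)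

open Equivalence using (to; from)

-- The ring solver quantifies over integers only, so a shift by k : ℕ enters as κ = + k.
private
  +1-rotate : ∀ a κ → a + κ + + 1 ≡ a + (+ 1 + κ)
  +1-rotate = solve-∀

  -1-rotate : ∀ a κ → a - κ - + 1 ≡ a - (+ 1 + κ)
  -1-rotate = solve-∀

  +1-swap : ∀ a κ → a + (+ 1 + κ) ≡ a + + 1 + κ
  +1-swap = solve-∀

  +1-cancel : ∀ a κ → a + + 1 - (+ 1 + κ) ≡ a - κ
  +1-cancel = solve-∀

  +1-inner : ∀ a b → a + (b + + 1) - + 1 ≡ a + b - + 1 + + 1
  +1-inner = solve-∀

  +1-outer : ∀ a b → a + + 1 + b - + 1 ≡ a + b - + 1 + + 1
  +1-outer = solve-∀

  pred-span : ∀ M m → M - (+ 1 + (M - m)) ≡ m - + 1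
  pred-span = solve-∀

  -1-commute : ∀ a κ → a - + 1 - κ ≡ a - (+ 1 + κ)
  -1-commute = solve-∀

i<i+1 : ∀ i → i < i + + 1
i<i+1 i = subst (i <_) (+-comm (+ 1) i) (suc[i]≤j⇒i<j ≤-refl)

i+1≢i : ∀ i → i + + 1 ≢ i
i+1≢i i eq = <-irrefl (sym eq) (i<i+1 i)

i<j⇒i+1≤j : ∀ {i j} → i < j → i + + 1 ≤ j
i<j⇒i+1≤j {i} i<j = subst (_≤ _) (+-comm (+ 1) i) (i<j⇒suc[i]≤j i<j)

i≤j-1⇔i<j : ∀ {i j} → i ≤ j - + 1 ⇔ i < j
i≤j-1⇔i<j {i} {j} rewrite +-comm j (- + 1) = mk⇔ i≤pred[j]⇒i<j i<j⇒i≤pred[j]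

idx-right : ∀ r c → idx (r , c + + 1) ≡ idx (r , c) + + 1
idx-right = +1-inner

idx-down : ∀ r c → idx (r + + 1 , c) ≡ idx (r , c) + + 1
idx-down = +1-outer

OrdinaryPos : Pos → Set
OrdinaryPos p = (+ 1 ≤ row p) × (+ 1 ≤ col p)

shift : ℕ → Pos → Pos
shift k p = (row p + + k , col p - + k)

shift-zero : ∀ p → shift 0 p ≡ p
shift-zero (r , c) = cong₂ _,_ (+-identityʳ r) (+-identityʳ c)

shift-suc : ∀ k p → shift 1 (shift k p) ≡ shift (suc k) p
shift-suc k (r , c) = cong₂ _,_ (+1-rotate r (+ k)) (-1-rotate c (+ k))

shift-suc-right : ∀ k r c → shift (suc k) (r , c + + 1) ≡ shift k (r + + 1 , c)
shift-suc-right k r c = cong₂ _,_ (+1-swap r (+ k)) (+1-cancel c (+ k))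

σ^≡map-shift : ∀ k P → σ^ k P ≡ map (shift k) P
σ^≡map-shift zero P = sym (trans (map-cong shift-zero P) (map-id P))
σ^≡map-shift (suc k) P = begin
  σ (σ^ k P)                    ≡⟨ cong σ (σ^≡map-shift k P) ⟩
  map (shift 1) (map (shift k) P) ≡⟨ map-∘ P ⟨
  map (shift 1 ∘′ shift k) P      ≡⟨ map-cong (shift-suc k) P ⟩
  map (shift (suc k)) P           ∎
  where open ≡-Reasoning

ShiftOrdinary : ℕ → Pos → Set
ShiftOrdinary k p = OrdinaryPos (shift k p)

ordinary-σ^⇔ : ∀ k P → Ordinary (σ^ k P) ⇔ All (ShiftOrdinary k) P
ordinary-σ^⇔ k P rewrite σ^≡map-shift k P = mk⇔ All.map⁻ All.map⁺

shiftOrdinary-row-mono : ∀ {k r r'} c → r ≤ r' → ShiftOrdinary k (r , c) → ShiftOrdinary k (r' , c)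
shiftOrdinary-row-mono {k} _ r≤r' (row-ok , col-ok) = ≤-trans row-ok (+-monoˡ-≤ (+ k) r≤r') , col-ok

shiftOrdinary⇒1≤col : ∀ {k} p → ShiftOrdinary k p → + 1 ≤ col p
shiftOrdinary⇒1≤col {k} p (_ , col-ok) = ≤-trans col-ok (i-j≤i (col p) (+ k))

RedOrdinary : ℕ → ℤ → Pos → Set
RedOrdinary k j p = (col p ≤ j → ShiftOrdinary k p) × (j < col p → ShiftOrdinary (suc k) p)

SplitOrdinary : ℕ → ℤ → SuperPD → Set
SplitOrdinary k j 𝐒 = All OrdinaryPos (Px 𝐒) × All (RedOrdinary k j) (Py 𝐒)

redOrdinary-here : ∀ {k j} r → RedOrdinary k j (r , j) ⇔ ShiftOrdinary k (r , j)
redOrdinary-here _ = mk⇔ (λ ok → proj₁ ok ≤-refl)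
                         (λ ok → (λ _ → ok) , λ j<j → ⊥-elim (<-irrefl refl j<j))

redOrdinary-next : ∀ {k j} r → RedOrdinary k j (r , j + + 1) ⇔ ShiftOrdinary k (r + + 1 , j)
redOrdinary-next {k} {j} r = mk⇔
  (λ ok → subst OrdinaryPos (shift-suc-right k r j) (proj₂ ok (i<i+1 j)))
  (λ ok → (λ j+1≤j → ⊥-elim (<⇒≱ (i<i+1 j) j+1≤j)) ,
          λ _ → subst OrdinaryPos (sym (shift-suc-right k r j)) ok)

redOrdinary-pred : ∀ {k j} p → col p ≢ j → RedOrdinary k j p ⇔ RedOrdinary k (j - + 1) p
redOrdinary-pred {j = j} p c≢j = mk⇔
  (λ (left-ok , right-ok) → (λ c≤j-1 → left-ok (<⇒≤ (to i≤j-1⇔i<j c≤j-1))) ,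
                            (λ j-1<c → right-ok (≤∧≢⇒< (j≤c j-1<c) (c≢j ∘′ sym))))
  (λ (left-ok , right-ok) → (λ c≤j → left-ok (from i≤j-1⇔i<j (≤∧≢⇒< c≤j c≢j))) ,
                            (λ j<c → right-ok (≤-<-trans (i-j≤i j (+ 1)) j<c)))
  where
  j≤c : j - + 1 < col p → j ≤ col p
  j≤c j-1<c = ≮⇒≥ λ c<j → <⇒≱ j-1<c (from i≤j-1⇔i<j c<j)

All-⇔ : ∀ {P Q : Pos → Set} {xs} → (∀ {x} → x ∈ xs → P x ⇔ Q x) → All P xs ⇔ All Q xs
All-⇔ P⇔Q = mk⇔ (λ ps → All.tabulate λ x∈ → to (P⇔Q x∈) (All.lookup ps x∈))
                (λ qs → All.tabulate λ x∈ → from (P⇔Q x∈) (All.lookup qs x∈))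

splitOrdinary-pred : ∀ {k j 𝐒} → NoRedInCol j 𝐒 → SplitOrdinary k j 𝐒 ⇔ SplitOrdinary k (j - + 1) 𝐒
splitOrdinary-pred {j = j} {𝐒} no-red = ⇔.refl ×-⇔ All-⇔ λ {p} p∈ → redOrdinary-pred p (col≢j p∈)
  where
  col≢j : ∀ {p} → p ∈ Py 𝐒 → col p ≢ j
  col≢j {r , _} p∈ refl = no-red r p∈

splitOrdinary-left : ∀ {k j 𝐒} → All (λ p → col p ≤ j) (Py 𝐒) →
  SplitOrdinary k j 𝐒 ⇔ (Ordinary (Px 𝐒) × Ordinary (σ^ k (Py 𝐒)))
splitOrdinary-left {k} {j} {𝐒} cols≤j =
  ⇔.refl ×-⇔ ⇔.trans (All-⇔ here) (⇔.sym (ordinary-σ^⇔ k (Py 𝐒)))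
  where
  here : ∀ {p} → p ∈ Py 𝐒 → RedOrdinary k j p ⇔ ShiftOrdinary k p
  here p∈ = mk⇔ (λ ok → proj₁ ok (All.lookup cols≤j p∈))
                (λ ok → (λ _ → ok) , λ j<c → ⊥-elim (<⇒≱ j<c (All.lookup cols≤j p∈)))

splitOrdinary-right : ∀ {k j 𝐒} → All (λ p → j < col p) (Py 𝐒) →
  SplitOrdinary k j 𝐒 ⇔ (Ordinary (Px 𝐒) × Ordinary (σ^ (suc k) (Py 𝐒)))
splitOrdinary-right {k} {j} {𝐒} cols>j =
  ⇔.refl ×-⇔ ⇔.trans (All-⇔ there) (⇔.sym (ordinary-σ^⇔ (suc k) (Py 𝐒)))
  where
  there : ∀ {p} → p ∈ Py 𝐒 → RedOrdinary k j p ⇔ ShiftOrdinary (suc k) p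
  there p∈ = mk⇔ (λ ok → proj₂ ok (All.lookup cols>j p∈))
                 (λ ok → (λ c≤j → ⊥-elim (<⇒≱ (All.lookup cols>j p∈) c≤j)) , λ _ → ok)

splitOrdinary-holds-row : ∀ {k j r 𝐒} → SplitOrdinary k j 𝐒 → holds 𝐒 (r , j) → + 1 ≤ r + + k
splitOrdinary-holds-row {k} {r = r} (blacks , _) (_ , inj₁ b∈) =
  ≤-trans (proj₁ (All.lookup blacks b∈)) (i≤i+j r (+ k))
splitOrdinary-holds-row {r = r} (_ , reds) (_ , inj₂ r∈) =
  proj₁ (to (redOrdinary-here r) (All.lookup reds r∈))

RedsAboveNext : ℤ → SuperPD → Set
RedsAboveNext j 𝐒 = ∀ {r r'} → (r , j) ∈ Py 𝐒 → (r' , j + + 1) ∈ Py 𝐒 → r < r'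

RedsInHFrom : ℤ → SuperPD → Set
RedsInHFrom m 𝐒 = All (λ p → inH p × m ≤ col p) (Py 𝐒)

inH-right : ∀ r c → inH (r , c) → inH (r , c + + 1)
inH-right r c h = subst (+ 1 ≤_) (sym (idx-right r c)) (≤-trans h (<⇒≤ (i<i+1 (idx (r , c)))))

inH-up-right : ∀ r c → inH (r + + 1 , c) → inH (r , c + + 1)
inH-up-right r c = subst (+ 1 ≤_) (trans (idx-down r c) (sym (idx-right r c)))

data SameRowSwap (j : ℤ) : Pos → Pos → Set where
  stay  : ∀ {p} → SameRowSwap j p p
  right : ∀ {r} → SameRowSwap j (r , j) (r , j + + 1)
  left  : ∀ {r} → SameRowSwap j (r , j + + 1) (r , j)

sameRowSwap-sym : ∀ {j p q} → SameRowSwap j p q → SameRowSwap j q p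
sameRowSwap-sym stay  = stay
sameRowSwap-sym right = left
sameRowSwap-sym left  = right

sameRowSwap-ordinary : ∀ {j p q} → + 1 ≤ j → SameRowSwap j p q → OrdinaryPos p → OrdinaryPos q
sameRowSwap-ordinary 1≤j stay  ok = ok
sameRowSwap-ordinary {j} 1≤j right (row-ok , _) = row-ok , ≤-trans 1≤j (<⇒≤ (i<i+1 j))
sameRowSwap-ordinary 1≤j left  (row-ok , _) = row-ok , 1≤j

map-sameRowSwap-ordinary⇔ : ∀ {j f X} → + 1 ≤ j → (∀ b → SameRowSwap j b (f b)) →
  All OrdinaryPos X ⇔ All OrdinaryPos (map f X)
map-sameRowSwap-ordinary⇔ 1≤j swap = mk⇔
  (λ ok → All.map⁺ (All.map (λ {b} → sameRowSwap-ordinary 1≤j (swap b)) ok))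
  (λ ok → All.map (λ {b} → sameRowSwap-ordinary 1≤j (sameRowSwap-sym (swap b))) (All.map⁻ ok))

-- exchange p q, exchangeBetween i' i j and moveRed p q are definitionally
-- mapS (swapPos p q), mapS (swapColumnsBetween i' i j) and map (moveTo p q) on Py.
swapPos : Pos → Pos → Pos → Pos
swapPos p q e = if e == p then q else if e == q then p else e

swapColumnsBetween : ℤ → ℤ → ℤ → Pos → Pos
swapColumnsBetween i' i j (r , c) =
  if does (i' <? r) ∧ does (r <? i)
  then (if does (c ≟ j) then (r , j + + 1)
        else if does (c ≟ (j + + 1)) then (r , j) else (r , c))
  else (r , c)

moveTo : Pos → Pos → Pos → Pos
moveTo p q e = if e == p then q else e

data SwapView (p q : Pos) : Pos → Pos → Set where
  first  : SwapView p q p q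
  second : SwapView p q q p
  other  : ∀ {e} → e ≢ p → e ≢ q → SwapView p q e e

swapPos-view : ∀ p q e → SwapView p q e (swapPos p q e)
swapPos-view p q e with e ≟P p
... | yes refl = first
... | no e≢p with e ≟P q
...   | yes refl = second
...   | no e≢q = other e≢p e≢q

swapPos-sameRowSwap : ∀ i j e → SameRowSwap j e (swapPos (i , j) (i , j + + 1) e)
swapPos-sameRowSwap i j e with swapPos (i , j) (i , j + + 1) e | swapPos-view (i , j) (i , j + + 1) e
... | _ | first     = right
... | _ | second    = left
... | _ | other _ _ = stay

data ColumnsBetweenView (i' i j r c : ℤ) : Pos → Set where
  to-right : i' < r → r < i → c ≡ j → ColumnsBetweenView i' i j r c (r , j + + 1)
  to-left  : i' < r → r < i → c ≡ j + + 1 → ColumnsBetweenView i' i j r c (r , j)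
  fixed    : (i' < r → r < i → c ≢ j) → ColumnsBetweenView i' i j r c (r , c)

swapColumnsBetween-view : ∀ i' i j r c → ColumnsBetweenView i' i j r c (swapColumnsBetween i' i j (r , c))
swapColumnsBetween-view i' i j r c with i' <? r | r <? i | c ≟ j | c ≟ (j + + 1)
... | yes i'<r | yes r<i | yes c≡j | _        = to-right i'<r r<i c≡j
... | yes i'<r | yes r<i | no c≢j  | yes c≡j' = to-left i'<r r<i c≡j'
... | yes _    | yes _   | no c≢j  | no _     = fixed λ _ _ → c≢j
... | yes _    | no r≮i  | _       | _        = fixed λ _ r<i → ⊥-elim (r≮i r<i)
... | no i'≮r  | _       | _       | _        = fixed λ i'<r → ⊥-elim (i'≮r i'<r)

swapColumnsBetween-sameRowSwap : ∀ i' i j e → SameRowSwap j e (swapColumnsBetween i' i j e)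
swapColumnsBetween-sameRowSwap i' i j (r , c)
  with swapColumnsBetween i' i j (r , c) | swapColumnsBetween-view i' i j r c
... | _ | to-right _ _ refl = right
... | _ | to-left _ _ refl  = left
... | _ | fixed _           = stay

module EmptyRight {m j i i' : ℤ} {𝐒 : SuperPD}
  (lowest : LowestRed j 𝐒 i) (i'<i : i' < i) (gap : ¬ holds 𝐒 (i' , j))
  (filled : ∀ r → i' < r → r < i → holds 𝐒 (r , j))
  (above : RedsAboveNext j 𝐒) (placed : RedsInHFrom m 𝐒) where

  𝐒' : SuperPD
  𝐒' = exchangeBetween i' i j (moveRed (i , j) (i' , j + + 1) 𝐒)

  flow : Pos → Pos
  flow = swapColumnsBetween i' i j ∘′ moveTo (i , j) (i' , j + + 1)

  data RedFlow : Pos → Pos → Set where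
    jump  : RedFlow (i , j) (i' , j + + 1)
    slide : ∀ {r} → i' < r → r < i → RedFlow (r , j) (r , j + + 1)
    stay  : ∀ {r c} → (c ≡ j → r < i') → (c ≡ j + + 1 → i < r) → RedFlow (r , c) (r , c)

  i∈ : (i , j) ∈ Py 𝐒
  i∈ = proj₁ lowest

  red-holds : ∀ {p} → p ∈ Py 𝐒 → holds 𝐒 p
  red-holds p∈ = proj₁ (All.lookup placed p∈) , inj₂ p∈

  red-left-of-gap : ∀ {r} → (r , j) ∈ Py 𝐒 → r ≢ i → ¬ (i' < r × r < i) → r < i'
  red-left-of-gap {r} r∈ r≢i outside =
    ≤∧≢⇒< (≮⇒≥ λ i'<r → outside (i'<r , ≤∧≢⇒< (proj₂ lowest r r∈) r≢i)) λ { refl → gap (red-holds r∈) }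

  redFlow : ∀ {e} → e ∈ Py 𝐒 → RedFlow e (flow e)
  redFlow {r , c} e∈ with (r , c) ≟P (i , j)
  ... | yes refl with swapColumnsBetween i' i j (i' , j + + 1) | swapColumnsBetween-view i' i j i' (j + + 1)
  ...   | _ | to-right i'<i' _ _ = ⊥-elim (<-irrefl refl i'<i')
  ...   | _ | to-left i'<i' _ _  = ⊥-elim (<-irrefl refl i'<i')
  ...   | _ | fixed _            = jump
  redFlow {r , c} e∈ | no e≢i with swapColumnsBetween i' i j (r , c) | swapColumnsBetween-view i' i j r c
  ...   | _ | to-right i'<r r<i refl = slide i'<r r<i
  ...   | _ | to-left _ r<i refl     = ⊥-elim (<-asym r<i (above i∈ e∈))
  ...   | _ | fixed outside          =
    stay (λ { refl → red-left-of-gap e∈ (λ { refl → e≢i refl })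
                                        λ (i'<r , r<i) → outside i'<r r<i refl })
         (λ { refl → above i∈ e∈ })

  flow-preimage : ∀ {p} → p ∈ Py 𝐒' → ∃ λ e → e ∈ Py 𝐒 × RedFlow e p
  flow-preimage p∈ with ∈-map⁻ (swapColumnsBetween i' i j) p∈
  ... | q , q∈ , refl with ∈-map⁻ (moveTo (i , j) (i' , j + + 1)) q∈
  ...   | e , e∈ , refl = e , e∈ , redFlow e∈

  flow-image : ∀ {e} → e ∈ Py 𝐒 → flow e ∈ Py 𝐒'
  flow-image e∈ = ∈-map⁺ _ (∈-map⁺ _ e∈)

  left-of-gap : ∀ {e p} → RedFlow e p → col p ≡ j → row p < i'
  left-of-gap jump        j+1≡j = ⊥-elim (i+1≢i j j+1≡j)
  left-of-gap (slide _ _) j+1≡j = ⊥-elim (i+1≢i j j+1≡j)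
  left-of-gap (stay left-of _) c≡j = left-of c≡j

  right-of-gap : ∀ {e p} → RedFlow e p → col p ≡ j + + 1 → i' ≤ row p
  right-of-gap jump             _ = ≤-refl
  right-of-gap (slide i'<r _)   _ = <⇒≤ i'<r
  right-of-gap (stay _ right-of) c≡j+1 = <⇒≤ (<-trans i'<i (right-of c≡j+1))

  above' : RedsAboveNext j 𝐒'
  above' p∈ q∈ with flow-preimage p∈ | flow-preimage q∈
  ... | _ , _ , v | _ , _ , w = <-≤-trans (left-of-gap v refl) (right-of-gap w refl)

  holds-below-gap : holds 𝐒 (i' + + 1 , j)
  holds-below-gap with i' + + 1 ≟ i
  ... | yes i'+1≡i = subst (λ r → holds 𝐒 (r , j)) (sym i'+1≡i) (red-holds i∈)
  ... | no i'+1≢i = filled (i' + + 1) (i<i+1 i') (≤∧≢⇒< (i<j⇒i+1≤j i'<i) i'+1≢i)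

  m≤j : m ≤ j
  m≤j = proj₂ (All.lookup placed i∈)

  placed-flow : ∀ {e p} → e ∈ Py 𝐒 → RedFlow e p → inH p × m ≤ col p
  placed-flow _  jump        = inH-up-right i' j (proj₁ holds-below-gap) , ≤-trans m≤j (<⇒≤ (i<i+1 j))
  placed-flow e∈ (slide {r} _ _) = inH-right r j (proj₁ (All.lookup placed e∈)) , ≤-trans m≤j (<⇒≤ (i<i+1 j))
  placed-flow e∈ (stay _ _)  = All.lookup placed e∈

  placed' : RedsInHFrom m 𝐒'
  placed' = All.tabulate λ p∈ → let (_ , e∈ , v) = flow-preimage p∈ in placed-flow e∈ v

  forward : ∀ k → SplitOrdinary k j 𝐒 → SplitOrdinary k j 𝐒'
  forward k inv@(blacks , reds) =
    to (map-sameRowSwap-ordinary⇔ 1≤j (swapColumnsBetween-sameRowSwap i' i j)) blacks ,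
    All.tabulate λ p∈ → let (_ , e∈ , v) = flow-preimage p∈ in red-forward e∈ v
    where
    at-i : ShiftOrdinary k (i , j)
    at-i = to (redOrdinary-here i) (All.lookup reds i∈)
    1≤j : + 1 ≤ j
    1≤j = shiftOrdinary⇒1≤col (i , j) at-i
    red-forward : ∀ {e p} → e ∈ Py 𝐒 → RedFlow e p → RedOrdinary k j p
    red-forward _  jump = from (redOrdinary-next i') (splitOrdinary-holds-row inv holds-below-gap , proj₂ at-i)
    red-forward e∈ (slide {r} _ _) =
      from (redOrdinary-next r)
           (shiftOrdinary-row-mono j (<⇒≤ (i<i+1 r)) (to (redOrdinary-here r) (All.lookup reds e∈)))
    red-forward e∈ (stay _ _) = All.lookup reds e∈

  backward : ∀ k → SplitOrdinary k j 𝐒' → SplitOrdinary k j 𝐒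
  backward k (blacks' , reds') =
    from (map-sameRowSwap-ordinary⇔ 1≤j (swapColumnsBetween-sameRowSwap i' i j)) blacks' ,
    All.tabulate λ e∈ → red-backward (redFlow e∈) (All.lookup reds' (flow-image e∈))
    where
    jumped : ∀ {p} → RedFlow (i , j) p → RedOrdinary k j p → ShiftOrdinary k (i' + + 1 , j)
    jumped jump ok = to (redOrdinary-next i') ok
    jumped (slide _ i<i) _ = ⊥-elim (<-irrefl refl i<i)
    jumped (stay left-of _) _ = ⊥-elim (<-asym i'<i (left-of refl))
    below-gap : ShiftOrdinary k (i' + + 1 , j)
    below-gap = jumped (redFlow i∈) (All.lookup reds' (flow-image i∈))
    1≤j : + 1 ≤ j
    1≤j = shiftOrdinary⇒1≤col (i' + + 1 , j) below-gap
    red-backward : ∀ {e p} → RedFlow e p → RedOrdinary k j p → RedOrdinary k j e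
    red-backward jump ok =
      from (redOrdinary-here i) (shiftOrdinary-row-mono j (i<j⇒i+1≤j i'<i) (to (redOrdinary-next i') ok))
    red-backward (slide {r} i'<r _) _ =
      from (redOrdinary-here r) (shiftOrdinary-row-mono j (i<j⇒i+1≤j i'<r) below-gap)
    red-backward (stay _ _) ok = ok

  splitOrdinary⇔ : ∀ k → SplitOrdinary k j 𝐒 ⇔ SplitOrdinary k j 𝐒'
  splitOrdinary⇔ k = mk⇔ (forward k) (backward k)

module FullRight {m j i : ℤ} {𝐒 : SuperPD}
  (lowest : LowestRed j 𝐒 i) (occupied : holds 𝐒 (i , j + + 1))
  (above : RedsAboveNext j 𝐒) (placed : RedsInHFrom m 𝐒) where

  𝐒' : SuperPD
  𝐒' = exchange (i , j) (i , j + + 1) 𝐒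

  swap : Pos → Pos
  swap = swapPos (i , j) (i , j + + 1)

  data RedSwap : Pos → Pos → Set where
    slide : RedSwap (i , j) (i , j + + 1)
    stay  : ∀ {r c} → (c ≡ j → r < i) → (c ≡ j + + 1 → i < r) → RedSwap (r , c) (r , c)

  i∈ : (i , j) ∈ Py 𝐒
  i∈ = proj₁ lowest

  no-red-right : ¬ (i , j + + 1) ∈ Py 𝐒
  no-red-right q∈ = <-irrefl refl (above i∈ q∈)

  black-right : (i , j + + 1) ∈ Px 𝐒
  black-right = [ id , ⊥-elim ∘′ no-red-right ] (proj₂ occupied)

  redSwap : ∀ {e} → e ∈ Py 𝐒 → RedSwap e (swap e)
  redSwap {e} e∈ with swap e | swapPos-view (i , j) (i , j + + 1) e
  ... | _ | first  = slide
  ... | _ | second = ⊥-elim (no-red-right e∈)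
  ... | _ | other {r , c} e≢i _ =
    stay (λ { refl → ≤∧≢⇒< (proj₂ lowest r e∈) λ { refl → e≢i refl } }) (λ { refl → above i∈ e∈ })

  swap-preimage : ∀ {p} → p ∈ Py 𝐒' → ∃ λ e → e ∈ Py 𝐒 × RedSwap e p
  swap-preimage p∈ with ∈-map⁻ swap p∈
  ... | e , e∈ , refl = e , e∈ , redSwap e∈

  left-of-i : ∀ {e p} → RedSwap e p → col p ≡ j → row p < i
  left-of-i slide            j+1≡j = ⊥-elim (i+1≢i j j+1≡j)
  left-of-i (stay left-of _) c≡j   = left-of c≡j

  right-of-i : ∀ {e p} → RedSwap e p → col p ≡ j + + 1 → i ≤ row p
  right-of-i slide             _     = ≤-refl
  right-of-i (stay _ right-of) c≡j+1 = <⇒≤ (right-of c≡j+1)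

  above' : RedsAboveNext j 𝐒'
  above' p∈ q∈ with swap-preimage p∈ | swap-preimage q∈
  ... | _ , _ , v | _ , _ , w = <-≤-trans (left-of-i v refl) (right-of-i w refl)

  placed-swap : ∀ {e p} → e ∈ Py 𝐒 → RedSwap e p → inH p × m ≤ col p
  placed-swap e∈ slide =
    let (in-H , m≤j) = All.lookup placed e∈ in inH-right i j in-H , ≤-trans m≤j (<⇒≤ (i<i+1 j))
  placed-swap e∈ (stay _ _) = All.lookup placed e∈

  placed' : RedsInHFrom m 𝐒'
  placed' = All.tabulate λ p∈ → let (_ , e∈ , v) = swap-preimage p∈ in placed-swap e∈ v

  forward : ∀ k → SplitOrdinary k j 𝐒 → SplitOrdinary k j 𝐒'
  forward k (blacks , reds) =
    to (map-sameRowSwap-ordinary⇔ 1≤j (swapPos-sameRowSwap i j)) blacks ,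
    All.tabulate λ p∈ → let (_ , e∈ , v) = swap-preimage p∈ in red-forward e∈ v
    where
    at-i : ShiftOrdinary k (i , j)
    at-i = to (redOrdinary-here i) (All.lookup reds i∈)
    1≤j : + 1 ≤ j
    1≤j = shiftOrdinary⇒1≤col (i , j) at-i
    red-forward : ∀ {e p} → e ∈ Py 𝐒 → RedSwap e p → RedOrdinary k j p
    red-forward _  slide      = from (redOrdinary-next i) (shiftOrdinary-row-mono j (<⇒≤ (i<i+1 i)) at-i)
    red-forward e∈ (stay _ _) = All.lookup reds e∈

  backward : ∀ k → SplitOrdinary k j 𝐒' → SplitOrdinary k j 𝐒
  backward k (blacks' , reds') =
    blacks , All.tabulate λ e∈ → red-backward (redSwap e∈) (All.lookup reds' (∈-map⁺ swap e∈))
    where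
    slid : ∀ {p} → RedSwap (i , j) p → RedOrdinary k j p → ShiftOrdinary k (i + + 1 , j)
    slid slide ok = to (redOrdinary-next i) ok
    slid (stay left-of _) _ = ⊥-elim (<-irrefl refl (left-of refl))
    below-i : ShiftOrdinary k (i + + 1 , j)
    below-i = slid (redSwap i∈) (All.lookup reds' (∈-map⁺ swap i∈))
    1≤j : + 1 ≤ j
    1≤j = shiftOrdinary⇒1≤col (i + + 1 , j) below-i
    blacks : All OrdinaryPos (Px 𝐒)
    blacks = from (map-sameRowSwap-ordinary⇔ 1≤j (swapPos-sameRowSwap i j)) blacks'
    at-i : ShiftOrdinary k (i , j)
    at-i = ≤-trans (proj₁ (All.lookup blacks black-right)) (i≤i+j i (+ k)) , proj₂ below-i
    red-backward : ∀ {e p} → RedSwap e p → RedOrdinary k j p → RedOrdinary k j e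
    red-backward slide      _  = from (redOrdinary-here i) at-i
    red-backward (stay _ _) ok = ok

  splitOrdinary⇔ : ∀ k → SplitOrdinary k j 𝐒 ⇔ SplitOrdinary k j 𝐒'
  splitOrdinary⇔ k = mk⇔ (forward k) (backward k)

flowStep-invariants : ∀ k {m j 𝐒 𝐒'} → FlowStep j 𝐒 𝐒' → RedsAboveNext j 𝐒 → RedsInHFrom m 𝐒 →
  RedsAboveNext j 𝐒' × RedsInHFrom m 𝐒' × (SplitOrdinary k j 𝐒 ⇔ SplitOrdinary k j 𝐒')
flowStep-invariants k (empty-right i i' lowest _ i'<i gap filled) above placed =
  E.above' , E.placed' , E.splitOrdinary⇔ k
  where module E = EmptyRight lowest i'<i gap filled above placed
flowStep-invariants k (full-right i lowest occupied) above placed =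
  F.above' , F.placed' , F.splitOrdinary⇔ k
  where module F = FullRight lowest occupied above placed

flowRun-invariants : ∀ k {m j 𝐒 𝐑} → FlowRun j 𝐒 𝐑 → RedsAboveNext j 𝐒 → RedsInHFrom m 𝐒 →
  RedsInHFrom m 𝐑 × NoRedInCol j 𝐑 × (SplitOrdinary k j 𝐒 ⇔ SplitOrdinary k j 𝐑)
flowRun-invariants k (done no-red) _ placed = placed , no-red , ⇔.refl
flowRun-invariants k (step s run) above placed =
  let (above₁ , placed₁ , eq₁) = flowStep-invariants k s above placed
      (placed₂ , no-red , eq₂) = flowRun-invariants k run above₁ placed₁
  in placed₂ , no-red , ⇔.trans eq₁ eq₂

yPlusCols-invariants : ∀ k {m M n 𝐒 𝐑} → YPlusCols M n 𝐒 𝐑 → RedsInHFrom m 𝐒 →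
  RedsInHFrom m 𝐑 × (SplitOrdinary k M 𝐒 ⇔ SplitOrdinary k (M - + n) 𝐑)
yPlusCols-invariants k {M = M} {𝐒 = 𝐒} none placed =
  placed , subst (λ j → SplitOrdinary k M 𝐒 ⇔ SplitOrdinary k j 𝐒) (sym (+-identityʳ M)) ⇔.refl
yPlusCols-invariants k {M = M} {suc n} {𝐒} {𝐑} (more (no-red-next , run) rest) placed =
  let (placed₁ , no-red , eq₁) = flowRun-invariants k run (λ _ q∈ → ⊥-elim (no-red-next _ q∈)) placed
      (placed₂ , eq₂) = yPlusCols-invariants k rest placed₁
  in placed₂ , ⇔.trans eq₁ (⇔.trans (splitOrdinary-pred no-red)
                 (subst (λ j → SplitOrdinary k (M - + 1) _ ⇔ SplitOrdinary k j 𝐑)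
                        (-1-commute M (+ n)) eq₂))

lemma6p4 : (w : Perm) (𝐏 : SuperPD) → 𝐏 ∈SPD w → (k : ℕ) →
    (m M : ℤ) → m ≤ M → RedsBetween m M 𝐏 →
    (𝐐 : SuperPD) → YPlusWith m M 𝐏 𝐐 →
    ((Ordinary (Px 𝐏) × Ordinary (σ^ k (Py 𝐏)))
      ⇔ (Ordinary (Px 𝐐) × Ordinary (σ^ (suc k) (Py 𝐐))))
lemma6p4 _ 𝐏 ((_ , reds-inH) , _) k m M m≤M between 𝐐 flow =
  ⇔.trans (⇔.sym (splitOrdinary-left (All.map proj₂ between)))
          (⇔.trans P⇔Q (splitOrdinary-right (All.map (λ (_ , m≤c) → <-≤-trans m-1<m m≤c) placed-𝐐)))
  where
  placed-𝐏 : RedsInHFrom m 𝐏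
  placed-𝐏 = All.zipWith (λ (in-H , m≤c , _) → in-H , m≤c) (reds-inH , between)
  placed-𝐐 : RedsInHFrom m 𝐐
  placed-𝐐 = proj₁ (yPlusCols-invariants k flow placed-𝐏)
  last-column : M - + suc ∣ M - m ∣ ≡ m - + 1
  last-column = trans (cong (λ n → M - (+ 1 + n)) (0≤i⇒+∣i∣≡i (i≤j⇒0≤j-i m≤M))) (pred-span M m)
  P⇔Q : SplitOrdinary k M 𝐏 ⇔ SplitOrdinary k (m - + 1) 𝐐
  P⇔Q = subst (λ j → SplitOrdinary k M 𝐏 ⇔ SplitOrdinary k j 𝐐) last-column
              (proj₂ (yPlusCols-invariants k flow placed-𝐏))
  m-1<m : m - + 1 < m
  m-1<m = to i≤j-1⇔i<j ≤-refl
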